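{- Let $\mathsf{L}^\star$ be any of the logics described in the context, $\mathsf{CS}$ any constant specification, and $\mathcal{M}=(W,W_0,V,E)$ any $\mathsf{L}^\star_{\mathsf{CS}}$-subset model. For all $\omega\in W_0$, all $A,B\in\mathcal{L}_J$ and all $s,t\in\mathsf{Tm}$: $\mathcal{M},\omega\Vdash s:(A\to B)\to\big(t:A\to (s+t+\mathsf{c}^\star):B\big)$.
   Context: Terms $\mathsf{Tm}$ are built from countably many constants $c_i$, countably many variables $x_i$ and one special constant $\mathsf{c}^\star$ by $t::=c_i\mid x_i\mid \mathsf{c}^\star\mid (t+t)\mid\ !t$, with $+$ left-associative (so $s+t+\mathsf{c}^\star=((s+t)+\mathsf{c}^\star)$). Formulas $\mathcal{L}_J$: $F::=p_i\mid\bot\mid F\to F\mid t:F$. The $\mathsf{c}^\star$-terms: $\mathsf{c}^\star$ is one, and if $c$ is one and $s,t$ are any terms then $s+c$ and $c+t$ are. Axiom schemes: (cl) classical propositional tautology axioms; (j+) $s:A\lor t:A\to(s+t):A$; (jc$^\star$) $c:A\land c:(A\to B)\to c:B$ for $\mathsf{c}^\star$-terms $c$; (j4) $t:A\to\ !t:(t:A)$; (jd) $t:\bot\to\bot$; (jt) $t:A\to A$. A logic $\mathsf{L}^\star$ consists of (cl),(j+),(jc$^\star$) and some subset of $\{$(j4),(jd),(jt)$\}$; a constant specification $\mathsf{CS}$ is a set of pairs $(c,A)$, $c$ a constant, $A$ an axiom of $\mathsf{L}^\star$. An $\mathsf{L}^\star_{\mathsf{CS}}$-subset model is $\mathcal{M}=(W,W_0,V,E)$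 with $W$ a set, $\emptyset\neq W_0\subseteq W$, $V:W\times\mathcal{L}_J\to\{0,1\}$, $E:W\times\mathsf{Tm}\to\mathcal{P}(W)$, such that, with $[A]=\{\upsilon: V(\upsilon,A)=1\}$ and $W_{MP}=\{\upsilon\in W:$ for all $A,B$, $V(\upsilon,A)=V(\upsilon,A\to B)=1$ implies $V(\upsilon,B)=1\}$, for all $\omega\in W_0$, $s,t\in\mathsf{Tm}$, $F,G\in\mathcal{L}_J$: $V(\omega,\bot)=0$; $V(\omega,F\to G)=1$ iff $V(\omega,F)=0$ or $V(\omega,G)=1$; $V(\omega,t:F)=1$ iff $E(\omega,t)\subseteq[F]$; $E(\omega,s+t)\subseteq E(\omega,s)\cap E(\omega,t)$; $E(\omega,\mathsf{c}^\star)\subseteq W_{MP}$; if (jd)$\in\mathsf{L}^\star$ some $\upsilon\in W_0$ lies in $E(\omega,t)$; if (jt)$\in\mathsf{L}^\star$ then $\omega\in E(\omega,t)$; if (j4)$\in\mathsf{L}^\star$ then $E(\omega,!t)\subseteq\{\upsilon:\forall F\,(V(\omega,t:F)=1\Rightarrow V(\upsilon,t:F)=1)\}$; for $(c,A)\in\mathsf{CS}$, $n\ge1$: $E(\omega,c)\subseteq[A]$ and $E(\omega,!^nc)\subseteq[!^{n-1}c:\cdots:\,!c:c:A]$ ($!^kc$ is $c$ preceded by $k$ copies of $!$). Truth: $\mathcal{M},\omega\Vdash F$ iff $V(\omega,F)=1$. -}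

module Defs where

open import Data.Nat using (ℕ; zero; suc)
open import Data.Bool using (Bool; true; false; _∨_; not)
open import Data.Product using (Σ; _×_)
open import Data.Sum using () renaming (_⊎_ to _⊎'_)
open import Relation.Binary.PropositionalEquality using (_≡_)
open import Level using (Level) renaming (suc to lsuc; zero to lzero)

infixl 6 _⊕_
data Tm : Set where
  con   : ℕ → Tm
  var   : ℕ → Tm
  c⋆    : Tm
  _⊕_   : Tm → Tm → Tm
  !_    : Tm → Tm

infixr 4 _⇒_
infix 5 _∶_
data Fm : Set where
  prop : ℕ → Fm
  ⊥'   : Fm
  _⇒_  : Fm → Fm → Fm
  _∶_  : Tm → Fm → Fm

¬'_ : Fm → Fm
¬' A = A ⇒ ⊥'

_∨'_ : Fm → Fm → Fm
A ∨' B = (¬' A) ⇒ B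

_∧'_ : Fm → Fm → Fm
A ∧' B = ¬' (A ⇒ ¬' B)

data IsC⋆ : Tm → Set where
  base  : IsC⋆ c⋆
  right : ∀ {s c} → IsC⋆ c → IsC⋆ (s ⊕ c)
  left  : ∀ {c t} → IsC⋆ c → IsC⋆ (c ⊕ t)

evalPL : (Fm → Bool) → Fm → Bool
evalPL v (prop i) = v (prop i)
evalPL v ⊥'       = false
evalPL v (A ⇒ B)  = not (evalPL v A) ∨ evalPL v B
evalPL v (t ∶ A)  = v (t ∶ A)

Tautology : Fm → Set
Tautology A = (v : Fm → Bool) → evalPL v A ≡ true

-- A logic L⋆: (cl),(j+),(jc⋆) plus a choice of (j4),(jd),(jt).
record Logic : Set where
  field
    hasJ4 : Bool
    hasJd : Bool
    hasJt : Bool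
open Logic public

!^ : ℕ → Tm → Tm
!^ zero    t = t
!^ (suc n) t = ! (!^ n t)

data Axiom (L : Logic) : Fm → Set where
  cl  : ∀ {A} → Tautology A → Axiom L A
  j+  : ∀ {s t A} → Axiom L (((s ∶ A) ∨' (t ∶ A)) ⇒ ((s ⊕ t) ∶ A))
  jc⋆ : ∀ {c A B} → IsC⋆ c → Axiom L (((c ∶ A) ∧' (c ∶ (A ⇒ B))) ⇒ (c ∶ B))
  j4  : ∀ {t A} → hasJ4 L ≡ true → Axiom L ((t ∶ A) ⇒ ((! t) ∶ (t ∶ A)))
  jd  : ∀ {t} → hasJd L ≡ true → Axiom L ((t ∶ ⊥') ⇒ ⊥')
  jt  : ∀ {t A} → hasJt L ≡ true → Axiom L ((t ∶ A) ⇒ A)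

record ConstSpec (L : Logic) : Set₁ where
  field
    InCS  : ℕ → Fm → Set
    isAx  : ∀ {c A} → InCS c A → Axiom L A
open ConstSpec public

chain : ℕ → ℕ → Fm → Fm
chain zero    c A = A
chain (suc n) c A = (!^ n (con c)) ∶ chain n c A

record SubsetModel (L : Logic) (CS : ConstSpec L) : Set₁ where
  field
    W   : Set
    W₀  : W → Set
    V   : W → Fm → Bool
    E   : W → Tm → W → Set

  ⟦_⟧ : Fm → W → Set
  ⟦ A ⟧ υ = V υ A ≡ true

  W-MP : W → Set
  W-MP υ = ∀ A B → V υ A ≡ true → V υ (A ⇒ B) ≡ true → V υ B ≡ true

  field
    W₀-nonempty : Σ W W₀
    V-⊥   : ∀ {ω} → W₀ ω → V ω ⊥' ≡ false
    V-⇒   : ∀ {ω} → W₀ ω → ∀ F G →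
              (V ω (F ⇒ G) ≡ true → (V ω F ≡ false ⊎' V ω G ≡ true)) ×
              ((V ω F ≡ false ⊎' V ω G ≡ true) → V ω (F ⇒ G) ≡ true)
    V-∶   : ∀ {ω} → W₀ ω → ∀ t F →
              (V ω (t ∶ F) ≡ true → ∀ υ → E ω t υ → ⟦ F ⟧ υ) ×
              ((∀ υ → E ω t υ → ⟦ F ⟧ υ) → V ω (t ∶ F) ≡ true)
    E-⊕   : ∀ {ω} → W₀ ω → ∀ s t υ → E ω (s ⊕ t) υ → E ω s υ × E ω t υ
    E-c⋆  : ∀ {ω} → W₀ ω → ∀ υ → E ω c⋆ υ → W-MP υ
    E-jd  : ∀ {ω} → W₀ ω → hasJd L ≡ true → ∀ t → Σ W (λ υ → W₀ υ × E ω t υ)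
    E-jt  : ∀ {ω} → W₀ ω → hasJt L ≡ true → ∀ t → E ω t ω
    E-j4  : ∀ {ω} → W₀ ω → hasJ4 L ≡ true → ∀ t υ → E ω (! t) υ →
              ∀ F → V ω (t ∶ F) ≡ true → V υ (t ∶ F) ≡ true
    E-CS  : ∀ {ω} → W₀ ω → ∀ {c A} → InCS CS c A → ∀ υ → E ω (con c) υ → ⟦ A ⟧ υ
    E-CS! : ∀ {ω} → W₀ ω → ∀ {c A} → InCS CS c A → ∀ (n : ℕ) → ∀ υ →
              E ω (!^ (suc n) (con c)) υ → ⟦ chain (suc n) c A ⟧ υ

  _⊩_ : W → Fm → Set
  ω ⊩ F = V ω F ≡ true

-- The sum s + t + c⋆ only admits worlds that s, t and c⋆ all admit; at such a
-- world A → B and A hold (from s and t) and modus ponens holds (from c⋆), so B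
-- holds. The outer implications are then discharged by the truth table of → at
-- the normal world ω.
module Submission where

open import Defs
open import Data.Bool using (true; false)
open import Data.Product using (proj₁; proj₂)
open import Data.Sum using (inj₁; inj₂)
open import Relation.Binary.PropositionalEquality using (refl)

module SubsetModelProperties {L : Logic} {CS : ConstSpec L} (M : SubsetModel L CS) where

  open SubsetModel M

  ⊩-⇒-intro : ∀ {ω} → W₀ ω → ∀ {F G} → (ω ⊩ F → ω ⊩ G) → ω ⊩ (F ⇒ G)
  ⊩-⇒-intro {ω} w₀ {F} {G} F→G with V ω F in eq
  ... | false = proj₂ (V-⇒ w₀ F G) (inj₁ eq)
  ... | true  = proj₂ (V-⇒ w₀ F G) (inj₂ (F→G refl))

  ⊩-∶-elim : ∀ {ω} → W₀ ω → ∀ {t F υ} → ω ⊩ (t ∶ F) → E ω t υ → υ ⊩ F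
  ⊩-∶-elim w₀ {t} {F} {υ} t∶F = proj₁ (V-∶ w₀ t F) t∶F υ

  ⊩-∶-intro : ∀ {ω} → W₀ ω → ∀ {t F} → (∀ {υ} → E ω t υ → υ ⊩ F) → ω ⊩ (t ∶ F)
  ⊩-∶-intro w₀ {t} {F} h = proj₂ (V-∶ w₀ t F) (λ υ → h {υ})

  E-⊕ˡ : ∀ {ω} → W₀ ω → ∀ {s t υ} → E ω (s ⊕ t) υ → E ω s υ
  E-⊕ˡ w₀ {s} {t} {υ} e = proj₁ (E-⊕ w₀ s t υ e)

  E-⊕ʳ : ∀ {ω} → W₀ ω → ∀ {s t υ} → E ω (s ⊕ t) υ → E ω t υ
  E-⊕ʳ w₀ {s} {t} {υ} e = proj₂ (E-⊕ w₀ s t υ e)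

  E-IsC⋆⊆W-MP : ∀ {ω} → W₀ ω → ∀ {c υ} → IsC⋆ c → E ω c υ → W-MP υ
  E-IsC⋆⊆W-MP w₀ {υ = υ} base  e = E-c⋆ w₀ υ e
  E-IsC⋆⊆W-MP w₀ (right c⋆c) e = E-IsC⋆⊆W-MP w₀ c⋆c (E-⊕ʳ w₀ e)
  E-IsC⋆⊆W-MP w₀ (left c⋆c)  e = E-IsC⋆⊆W-MP w₀ c⋆c (E-⊕ˡ w₀ e)

  ⊩-application : ∀ {ω} → W₀ ω → ∀ {A B s t c} → IsC⋆ c →
                  ω ⊩ (s ∶ (A ⇒ B)) → ω ⊩ (t ∶ A) → ω ⊩ ((s ⊕ t ⊕ c) ∶ B)
  ⊩-application w₀ {A} {B} c⋆c s∶A⇒B t∶A = ⊩-∶-intro w₀ λ e →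
    let e-st = E-⊕ˡ w₀ e
    in E-IsC⋆⊆W-MP w₀ c⋆c (E-⊕ʳ w₀ e) A B
         (⊩-∶-elim w₀ t∶A (E-⊕ʳ w₀ e-st))
         (⊩-∶-elim w₀ s∶A⇒B (E-⊕ˡ w₀ e-st))

mainTheorem2 : (L : Logic) (CS : ConstSpec L) (M : SubsetModel L CS) →
    let open SubsetModel M in
    ∀ (ω : W) → W₀ ω → ∀ (A B : Fm) (s t : Tm) →
      ω ⊩ ((s ∶ (A ⇒ B)) ⇒ ((t ∶ A) ⇒ ((s ⊕ t ⊕ c⋆) ∶ B)))
mainTheorem2 L CS M ω w₀ A B s t =
  ⊩-⇒-intro w₀ λ s∶A⇒B → ⊩-⇒-intro w₀ λ t∶A → ⊩-application w₀ base s∶A⇒B t∶A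
  where open SubsetModelProperties M
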